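{- Let $n$ be a non-negative integer and $s$ any integer. Then \[ \sum_{j = 0}^{2n} \frac{F_{j + s}}{2^{j + 1} \binom {2n}j} = \frac{2n + 1}{5^{n + 1}}\left( F_{s - 1} \sum_{j = 1}^n \frac{5^j}{2j} + L_{s - 1} \sum_{j = 0}^n \frac{5^j}{2j + 1} \right) + \frac{2n + 1}{5^{n + 1}}\left( \sum_{j = 1}^n \frac{5^j F_{2j + s - 1}}{2^{2j}\, 2j} + \sum_{j = 0}^n \frac{5^j L_{2j + s}}{2^{2j + 1} (2j + 1)} \right), \] and \[ \sum_{j = 0}^{2n} \frac{L_{j + s}}{2^{j + 1} \binom {2n}j} = \frac{2n + 1}{5^n}\left( F_{s - 1} \sum_{j = 0}^n \frac{5^j}{2j + 1} + L_{s - 1} \sum_{j = 1}^n \frac{5^{j - 1}}{2j} \right) + \frac{2n + 1}{5^n}\left( \sum_{j = 0}^n \frac{5^j F_{2j + s}}{2^{2j + 1} (2j + 1)} + \sum_{j = 1}^n \frac{5^{j - 1} L_{2j + s - 1}}{2^{2j}\, 2j} \right). \]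
   Context: $F_j$ and $L_j$ denote the Fibonacci and Lucas numbers, defined for all integers $j$ by $F_0=0$, $F_1=1$, $L_0=2$, $L_1=1$, $F_j=F_{j-1}+F_{j-2}$, $L_j=L_{j-1}+L_{j-2}$, extended to negative indices by $F_{ -j}=(-1)^{j-1}F_j$, $L_{ -j}=(-1)^jL_j$; equivalently $F_j=(\alpha^j-\beta^j)/\sqrt5$, $L_j=\alpha^j+\beta^j$ with $\alpha=(1+\sqrt5)/2$, $\beta=(1-\sqrt5)/2$. Empty sums are zero. -}

module Defs where

open import Data.Nat as ℕ using (ℕ; zero; suc)
open import Data.Nat.Combinatorics using (_C_)
open import Data.Integer as ℤ using (ℤ; +_; -[1+_])
open import Data.Rational as ℚ using (ℚ)

fibℕ : ℕ → ℕ
fibℕ zero = 0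
fibℕ (suc zero) = 1
fibℕ (suc (suc n)) = fibℕ (suc n) ℕ.+ fibℕ n

lucℕ : ℕ → ℕ
lucℕ zero = 2
lucℕ (suc zero) = 1
lucℕ (suc (suc n)) = lucℕ (suc n) ℕ.+ lucℕ n

sgn : ℕ → ℤ
sgn zero = + 1
sgn (suc k) = ℤ.- sgn k

-- Extension to all integer indices:
--   F_{-j} = (-1)^{j-1} F_j ,  L_{-j} = (-1)^j L_j   (here j = k+1)
F : ℤ → ℤ
F (+ n) = + fibℕ n
F -[1+ k ] = sgn k ℤ.* + fibℕ (suc k)

L : ℤ → ℤ
L (+ n) = + lucℕ n
L -[1+ k ] = sgn (suc k) ℤ.* + lucℕ (suc k)

-- z / d as a rational number; only ever used with d > 0 below
-- (the value at d = 0 is an irrelevant junk value 0).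
_/ℕ_ : ℤ → ℕ → ℚ
z /ℕ zero = ℚ.0ℚ
z /ℕ suc d = z ℚ./ suc d

-- Σ_{j = a}^{b} f j  (empty, i.e. 0, when b < a), via Σ_{i=0}^{len-1} f (a+i)
sumFrom : ℕ → ℕ → (ℕ → ℚ) → ℚ
sumFrom a zero f = ℚ.0ℚ
sumFrom a (suc len) f = f a ℚ.+ sumFrom (suc a) len f

∑[_,_] : ℕ → ℕ → (ℕ → ℚ) → ℚ
∑[ a , b ] f = sumFrom a (suc b ℕ.∸ a) f

-- Write S_m(g) = Σ_{k=0}^{m} g(k+1) / (2^{k+1} C(m,k)); the left-hand sides are S_{2n} of the
-- sequences g(k) = F_{k+s-1} and g(k) = L_{k+s-1}.  The reciprocal Pascal rule
--   (m+2)/C(m,k) = (m+1) (1/C(m+1,k) + 1/C(m+1,k+1))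
-- turns S_m(g)/(m+1) into c S_{m+1}(h)/(m+2) minus a boundary term in g(0) and g(m+2), as soon
-- as c h(k+1) = g(k+1) + 2 g(k).  Fibonacci and Lucas numbers are coupled like this in both
-- directions, L_M = F_M + 2 F_{M-1} and 5 F_M = L_M + 2 L_{M-1}, so two steps relate S_{2n+2}
-- to S_{2n} with the factor 5, and unrolling the recursion collects the boundary terms into
-- the sums on the right-hand sides.
module Submission where

open import Defs
open import Data.Integer as ℤ using (ℤ; +_; -[1+_])
import Data.Integer.Properties as ℤ
import Data.Integer.Solver as ℤSolver
open import Data.Nat as ℕ using (ℕ; zero; suc; NonZero)
open import Data.Nat.Combinatorics using (_C_; nCk+nC[k+1]≡[n+1]C[k+1]; nC1≡n; nCn≡1)
import Data.Nat.Properties as ℕ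
import Data.Nat.Solver as ℕSolver
open import Data.Product using (_×_; _,_)
open import Data.Rational as ℚ using (ℚ; _/_; 0ℚ; 1ℚ; _+_; _*_; _-_; fromℚᵘ)
import Data.Rational.Properties as ℚ
open import Algebra.Definitions.RawSemiring ℚ.+-*-rawSemiring using (_^_)
import Data.Rational.Solver as ℚSolver
open import Data.Rational.Unnormalised as ℚᵘ using (mkℚᵘ; *≡*)
import Data.Rational.Unnormalised.Properties as ℚᵘ
open import Function using (_∘_)
open import Relation.Binary.PropositionalEquality

module NS = ℕSolver.+-*-Solver
module ZS = ℤSolver.+-*-Solver
module QS = ℚSolver.+-*-Solver

-- Integers and reciprocals of naturals in ℚ

fromℚᵘ-homo-* : ∀ p q → fromℚᵘ (p ℚᵘ.* q) ≡ fromℚᵘ p * fromℚᵘ q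
fromℚᵘ-homo-* p q = ℚ.toℚᵘ-injective (ℚᵘ.≃-trans (ℚ.toℚᵘ-fromℚᵘ (p ℚᵘ.* q)) (ℚᵘ.≃-sym
  (ℚᵘ.≃-trans (ℚ.toℚᵘ-homo-* (fromℚᵘ p) (fromℚᵘ q)) (ℚᵘ.*-cong (ℚ.toℚᵘ-fromℚᵘ p) (ℚ.toℚᵘ-fromℚᵘ q)))))

fromℚᵘ-homo-+ : ∀ p q → fromℚᵘ (p ℚᵘ.+ q) ≡ fromℚᵘ p + fromℚᵘ q
fromℚᵘ-homo-+ p q = ℚ.toℚᵘ-injective (ℚᵘ.≃-trans (ℚ.toℚᵘ-fromℚᵘ (p ℚᵘ.+ q)) (ℚᵘ.≃-sym
  (ℚᵘ.≃-trans (ℚ.toℚᵘ-homo-+ (fromℚᵘ p) (fromℚᵘ q)) (ℚᵘ.+-cong (ℚ.toℚᵘ-fromℚᵘ p) (ℚ.toℚᵘ-fromℚᵘ q)))))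

-- Opaque, so that unification never unfolds the normalising division.
opaque
  fromℤ : ℤ → ℚ
  fromℤ z = z / 1

  -- 1/ℕ 0 = 0, inherited from _/ℕ_.
  1/ℕ_ : ℕ → ℚ
  1/ℕ n = (+ 1) /ℕ n

  fromℤ-* : ∀ a b → fromℤ (a ℤ.* b) ≡ fromℤ a * fromℤ b
  fromℤ-* a b = fromℚᵘ-homo-* (mkℚᵘ a 0) (mkℚᵘ b 0)

  fromℤ-+ : ∀ a b → fromℤ (a ℤ.+ b) ≡ fromℤ a + fromℤ b
  fromℤ-+ a b = trans (ℚ.fromℚᵘ-cong {mkℚᵘ (a ℤ.+ b) 0} {mkℚᵘ a 0 ℚᵘ.+ mkℚᵘ b 0} (*≡* eq))
    (fromℚᵘ-homo-+ (mkℚᵘ a 0) (mkℚᵘ b 0))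
    where
    open ZS
    eq : (a ℤ.+ b) ℤ.* + 1 ≡ (a ℤ.* + 1 ℤ.+ b ℤ.* + 1) ℤ.* + 1
    eq = solve 2 (λ a b → (a :+ b) :* con (+ 1) := (a :* con (+ 1) :+ b :* con (+ 1)) :* con (+ 1)) refl a b

  /ℕ-as-* : ∀ z n → z /ℕ n ≡ fromℤ z * 1/ℕ n
  /ℕ-as-* z zero = sym (ℚ.*-zeroʳ (fromℤ z))
  /ℕ-as-* z (suc d) = trans (ℚ.fromℚᵘ-cong {mkℚᵘ z d} {mkℚᵘ z 0 ℚᵘ.* mkℚᵘ (+ 1) d} (*≡* eq))
    (fromℚᵘ-homo-* (mkℚᵘ z 0) (mkℚᵘ (+ 1) d))
    where
    open ZS
    eq : z ℤ.* + (1 ℕ.* suc d) ≡ (z ℤ.* + 1) ℤ.* + suc d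
    eq = trans (cong (λ n → z ℤ.* + n) (ℕ.*-identityˡ (suc d))) (cong (ℤ._* + suc d) (sym (ℤ.*-identityʳ z)))

  1/ℕ-* : ∀ m n → 1/ℕ (m ℕ.* n) ≡ 1/ℕ m * 1/ℕ n
  1/ℕ-* zero n = sym (ℚ.*-zeroˡ (1/ℕ n))
  1/ℕ-* (suc m) zero rewrite ℕ.*-zeroʳ m = sym (ℚ.*-zeroʳ (1/ℕ suc m))
  1/ℕ-* (suc m) (suc n) = fromℚᵘ-homo-* (mkℚᵘ (+ 1) m) (mkℚᵘ (+ 1) n)

  fromℕ*1/ℕ : ∀ n .{{_ : NonZero n}} → fromℤ (+ n) * 1/ℕ n ≡ 1ℚ
  fromℕ*1/ℕ (suc d) = trans (sym (fromℚᵘ-homo-* (mkℚᵘ (+ suc d) 0) (mkℚᵘ (+ 1) d)))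
    (ℚ.fromℚᵘ-cong {mkℚᵘ (+ suc d) 0 ℚᵘ.* mkℚᵘ (+ 1) d} {mkℚᵘ (+ 1) 0} (*≡* eq))
    where
    open ZS
    eq : (+ suc d ℤ.* + 1) ℤ.* + 1 ≡ + 1 ℤ.* + (1 ℕ.* suc d)
    eq = trans (solve 1 (λ d → (d :* con (+ 1)) :* con (+ 1) := con (+ 1) :* d) refl (+ suc d))
      (cong (λ n → + 1 ℤ.* + n) (sym (ℕ.*-identityˡ (suc d))))

  z/1≡fromℤ : ∀ z → z / 1 ≡ fromℤ z
  z/1≡fromℤ z = refl

  1/ℕ1≡1 : 1/ℕ 1 ≡ 1ℚ
  1/ℕ1≡1 = refl

fromℕ : ℕ → ℚ
fromℕ n = fromℤ (+ n)

fromℕ-1 : fromℕ 1 ≡ 1ℚ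
fromℕ-1 = sym (z/1≡fromℤ (+ 1))

fromℕ-+ : ∀ m n → fromℕ (m ℕ.+ n) ≡ fromℕ m + fromℕ n
fromℕ-+ m n = fromℤ-+ (+ m) (+ n)

fromℕ-* : ∀ m n → fromℕ (m ℕ.* n) ≡ fromℕ m * fromℕ n
fromℕ-* m n = trans (cong fromℤ (ℤ.pos-* m n)) (fromℤ-* (+ m) (+ n))

fromℕ-^ : ∀ m n → fromℕ (m ℕ.^ n) ≡ fromℕ m ^ n
fromℕ-^ m zero = fromℕ-1
fromℕ-^ m (suc n) = trans (fromℕ-* m (m ℕ.^ n)) (cong (fromℕ m *_) (fromℕ-^ m n))

-- Binomial coefficients

k≤n⇒0<nCk : ∀ {n k} → k ℕ.≤ n → 0 ℕ.< n C k
k≤n⇒0<nCk {k = zero} _ = ℕ.s≤s ℕ.z≤n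
k≤n⇒0<nCk {suc n} {suc k} (ℕ.s≤s k≤n) =
  subst (0 ℕ.<_) (nCk+nC[k+1]≡[n+1]C[k+1] n k) (ℕ.<-≤-trans (k≤n⇒0<nCk k≤n) (ℕ.m≤m+n _ _))

[k+1]*[n+1]C[k+1]≡[n+1]*nCk : ∀ n k → suc k ℕ.* (suc n C suc k) ≡ suc n ℕ.* (n C k)
[k+1]*[n+1]C[k+1]≡[n+1]*nCk zero zero = refl
[k+1]*[n+1]C[k+1]≡[n+1]*nCk zero (suc k) = ℕ.*-zeroʳ (2 ℕ.+ k)
[k+1]*[n+1]C[k+1]≡[n+1]*nCk (suc n) zero = trans (ℕ.*-identityˡ _) (trans (nC1≡n (2 ℕ.+ n)) (sym (ℕ.*-identityʳ _)))
[k+1]*[n+1]C[k+1]≡[n+1]*nCk (suc n) (suc k) = begin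
    (2 ℕ.+ k) ℕ.* ((2 ℕ.+ n) C (2 ℕ.+ k))
      ≡⟨ cong ((2 ℕ.+ k) ℕ.*_) (nCk+nC[k+1]≡[n+1]C[k+1] (suc n) (suc k)) ⟨
    (2 ℕ.+ k) ℕ.* (d ℕ.+ e)
      ≡⟨ solve 3 (λ k d e → (con 2 :+ k) :* (d :+ e) := d :+ (con 1 :+ k) :* d :+ (con 2 :+ k) :* e) refl k d e ⟩
    d ℕ.+ suc k ℕ.* d ℕ.+ (2 ℕ.+ k) ℕ.* e
      ≡⟨ cong₂ (λ x y → d ℕ.+ x ℕ.+ y) ([k+1]*[n+1]C[k+1]≡[n+1]*nCk n k) ([k+1]*[n+1]C[k+1]≡[n+1]*nCk n (suc k)) ⟩
    d ℕ.+ suc n ℕ.* (n C k) ℕ.+ suc n ℕ.* (n C suc k)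
      ≡⟨ solve 4 (λ n d c c' → d :+ (con 1 :+ n) :* c :+ (con 1 :+ n) :* c' := d :+ (con 1 :+ n) :* (c :+ c')) refl n d (n C k) (n C suc k) ⟩
    d ℕ.+ suc n ℕ.* (n C k ℕ.+ n C suc k)
      ≡⟨ cong (λ x → d ℕ.+ suc n ℕ.* x) (nCk+nC[k+1]≡[n+1]C[k+1] n k) ⟩
    (2 ℕ.+ n) ℕ.* d ∎
  where
  open ≡-Reasoning
  open NS
  d e : ℕ
  d = suc n C suc k
  e = suc n C (2 ℕ.+ k)

[n+2]*[n+1]Ck*[n+1]C[k+1]≡[n+1]*nCk*[n+2]C[k+1] : ∀ n k →
  (2 ℕ.+ n) ℕ.* (suc n C k) ℕ.* (suc n C suc k) ≡ suc n ℕ.* (n C k) ℕ.* ((2 ℕ.+ n) C suc k)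
[n+2]*[n+1]Ck*[n+1]C[k+1]≡[n+1]*nCk*[n+2]C[k+1] n k = ℕ.*-cancelˡ-≡ _ _ (suc k) (begin
    suc k ℕ.* ((2 ℕ.+ n) ℕ.* d ℕ.* e)
      ≡⟨ solve 4 (λ k n d e → (con 1 :+ k) :* ((con 2 :+ n) :* d :* e) := ((con 2 :+ n) :* d) :* ((con 1 :+ k) :* e)) refl k n d e ⟩
    ((2 ℕ.+ n) ℕ.* d) ℕ.* (suc k ℕ.* e)
      ≡⟨ cong₂ ℕ._*_ (sym ([k+1]*[n+1]C[k+1]≡[n+1]*nCk (suc n) k)) ([k+1]*[n+1]C[k+1]≡[n+1]*nCk n k) ⟩
    (suc k ℕ.* f) ℕ.* (suc n ℕ.* c)
      ≡⟨ solve 4 (λ k n c f → ((con 1 :+ k) :* f) :* ((con 1 :+ n) :* c) := (con 1 :+ k) :* ((con 1 :+ n) :* c :* f)) refl k n c f ⟩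
    suc k ℕ.* (suc n ℕ.* c ℕ.* f) ∎)
  where
  open ≡-Reasoning
  open NS
  c d e f : ℕ
  c = n C k
  d = suc n C k
  e = suc n C suc k
  f = (2 ℕ.+ n) C suc k

*-inverse-cross : ∀ {a b c d e c⁻¹ d⁻¹ e⁻¹ : ℚ} → c * c⁻¹ ≡ 1ℚ → d * d⁻¹ ≡ 1ℚ → e * e⁻¹ ≡ 1ℚ →
  a * d * e ≡ b * c * (d + e) → a * c⁻¹ ≡ b * (d⁻¹ + e⁻¹)
*-inverse-cross {a} {b} {c} {d} {e} {c⁻¹} {d⁻¹} {e⁻¹} cc⁻¹ dd⁻¹ ee⁻¹ ade≡bc[d+e] = begin
    a * c⁻¹
      ≡⟨ solve 2 (λ a c⁻¹ → a :* c⁻¹ := a :* c⁻¹ :* con 1ℚ :* con 1ℚ) refl a c⁻¹ ⟩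
    a * c⁻¹ * 1ℚ * 1ℚ
      ≡⟨ cong₂ (λ x y → a * c⁻¹ * x * y) dd⁻¹ ee⁻¹ ⟨
    a * c⁻¹ * (d * d⁻¹) * (e * e⁻¹)
      ≡⟨ solve 6 (λ a c⁻¹ d d⁻¹ e e⁻¹ → a :* c⁻¹ :* (d :* d⁻¹) :* (e :* e⁻¹) := (a :* d :* e) :* (c⁻¹ :* d⁻¹ :* e⁻¹))
           refl a c⁻¹ d d⁻¹ e e⁻¹ ⟩
    (a * d * e) * (c⁻¹ * d⁻¹ * e⁻¹)
      ≡⟨ cong (_* (c⁻¹ * d⁻¹ * e⁻¹)) ade≡bc[d+e] ⟩
    (b * c * (d + e)) * (c⁻¹ * d⁻¹ * e⁻¹)
      ≡⟨ solve 7 (λ b c d e c⁻¹ d⁻¹ e⁻¹ → (b :* c :* (d :+ e)) :* (c⁻¹ :* d⁻¹ :* e⁻¹)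
             := b :* (c :* c⁻¹) :* ((d :* d⁻¹) :* e⁻¹ :+ (e :* e⁻¹) :* d⁻¹))
           refl b c d e c⁻¹ d⁻¹ e⁻¹ ⟩
    b * (c * c⁻¹) * ((d * d⁻¹) * e⁻¹ + (e * e⁻¹) * d⁻¹)
      ≡⟨ cong₂ (λ x y → b * x * y) cc⁻¹ (cong₂ (λ x y → x * e⁻¹ + y * d⁻¹) dd⁻¹ ee⁻¹) ⟩
    b * 1ℚ * (1ℚ * e⁻¹ + 1ℚ * d⁻¹)
      ≡⟨ solve 3 (λ b d⁻¹ e⁻¹ → b :* con 1ℚ :* (con 1ℚ :* e⁻¹ :+ con 1ℚ :* d⁻¹) := b :* (d⁻¹ :+ e⁻¹)) refl b d⁻¹ e⁻¹ ⟩
    b * (d⁻¹ + e⁻¹) ∎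
  where
  open ≡-Reasoning
  open QS

fromℕ*1/ℕnCk : ∀ {n k} → k ℕ.≤ n → fromℕ (n C k) * 1/ℕ (n C k) ≡ 1ℚ
fromℕ*1/ℕnCk k≤n = fromℕ*1/ℕ _ {{ℕ.>-nonZero (k≤n⇒0<nCk k≤n)}}

1/nCk-Pascal : ∀ {n k} → k ℕ.≤ n →
  fromℕ (2 ℕ.+ n) * 1/ℕ (n C k) ≡ fromℕ (suc n) * (1/ℕ (suc n C k) + 1/ℕ (suc n C suc k))
1/nCk-Pascal {n} {k} k≤n = *-inverse-cross {fromℕ (2 ℕ.+ n)} {fromℕ (suc n)} {fromℕ c} {fromℕ d} {fromℕ e}
  (fromℕ*1/ℕnCk k≤n) (fromℕ*1/ℕnCk (ℕ.m≤n⇒m≤1+n k≤n)) (fromℕ*1/ℕnCk (ℕ.s≤s k≤n)) (begin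
    fromℕ (2 ℕ.+ n) * fromℕ d * fromℕ e
      ≡⟨ cong (_* fromℕ e) (fromℕ-* (2 ℕ.+ n) d) ⟨
    fromℕ ((2 ℕ.+ n) ℕ.* d) * fromℕ e
      ≡⟨ fromℕ-* ((2 ℕ.+ n) ℕ.* d) e ⟨
    fromℕ ((2 ℕ.+ n) ℕ.* d ℕ.* e)
      ≡⟨ cong fromℕ ([n+2]*[n+1]Ck*[n+1]C[k+1]≡[n+1]*nCk*[n+2]C[k+1] n k) ⟩
    fromℕ (suc n ℕ.* c ℕ.* ((2 ℕ.+ n) C suc k))
      ≡⟨ cong (λ x → fromℕ (suc n ℕ.* c ℕ.* x)) (nCk+nC[k+1]≡[n+1]C[k+1] (suc n) k) ⟨
    fromℕ (suc n ℕ.* c ℕ.* (d ℕ.+ e))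
      ≡⟨ trans (fromℕ-* (suc n ℕ.* c) (d ℕ.+ e)) (cong₂ _*_ (fromℕ-* (suc n) c) (fromℕ-+ d e)) ⟩
    fromℕ (suc n) * fromℕ c * (fromℕ d + fromℕ e) ∎)
  where
  open ≡-Reasoning
  c d e : ℕ
  c = n C k
  d = suc n C k
  e = suc n C suc k

-- Finite sums

sumFrom-cong : ∀ a n {f g : ℕ → ℚ} → (∀ i → a ℕ.≤ i → i ℕ.< a ℕ.+ n → f i ≡ g i) → sumFrom a n f ≡ sumFrom a n g
sumFrom-cong a zero f≗g = refl
sumFrom-cong a (suc n) f≗g = cong₂ _+_ (f≗g a ℕ.≤-refl (ℕ.m<m+n a (ℕ.s≤s ℕ.z≤n)))
  (sumFrom-cong (suc a) n (λ i a<i i<a+n → f≗g i (ℕ.<⇒≤ a<i) (ℕ.<-≤-trans i<a+n (ℕ.≤-reflexive (sym (ℕ.+-suc a n))))))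

sumFrom-+ : ∀ a n (f g : ℕ → ℚ) → sumFrom a n (λ i → f i + g i) ≡ sumFrom a n f + sumFrom a n g
sumFrom-+ a zero f g = refl
sumFrom-+ a (suc n) f g = trans (cong (_+_ (f a + g a)) (sumFrom-+ (suc a) n f g))
  (solve 4 (λ x y u v → x :+ y :+ (u :+ v) := x :+ u :+ (y :+ v)) refl (f a) (g a) (sumFrom (suc a) n f) (sumFrom (suc a) n g))
  where open QS

*-distribˡ-sumFrom : ∀ c a n (f : ℕ → ℚ) → c * sumFrom a n f ≡ sumFrom a n (λ i → c * f i)
*-distribˡ-sumFrom c a zero f = ℚ.*-zeroʳ c
*-distribˡ-sumFrom c a (suc n) f = trans (ℚ.*-distribˡ-+ c (f a) _) (cong (_+_ (c * f a)) (*-distribˡ-sumFrom c (suc a) n f))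

sumFrom-snoc : ∀ a n (f : ℕ → ℚ) → sumFrom a (suc n) f ≡ sumFrom a n f + f (a ℕ.+ n)
sumFrom-snoc a zero f = trans (ℚ.+-identityʳ (f a)) (trans (sym (ℚ.+-identityˡ (f a))) (cong (λ i → 0ℚ + f i) (sym (ℕ.+-identityʳ a))))
sumFrom-snoc a (suc n) f = trans (cong (_+_ (f a)) (sumFrom-snoc (suc a) n f))
  (trans (sym (ℚ.+-assoc (f a) _ _)) (cong (λ i → f a + sumFrom (suc a) n f + f i) (sym (ℕ.+-suc a n))))

sumFrom-shifted-+ : ∀ a n (p q : ℕ → ℚ) →
  sumFrom a n (λ k → p k + q (suc k)) + p (a ℕ.+ n) + q a ≡ sumFrom a (suc n) (λ k → p k + q k)
sumFrom-shifted-+ a zero p q = trans (cong (λ i → 0ℚ + p i + q a) (ℕ.+-identityʳ a))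
  (solve 2 (λ x y → con 0ℚ :+ x :+ y := x :+ y :+ con 0ℚ) refl (p a) (q a))
  where open QS
sumFrom-shifted-+ a (suc n) p q = begin
    p a + q (suc a) + Σ' + p (a ℕ.+ suc n) + q a
      ≡⟨ cong (λ i → p a + q (suc a) + Σ' + p i + q a) (ℕ.+-suc a n) ⟩
    p a + q (suc a) + Σ' + p (suc a ℕ.+ n) + q a
      ≡⟨ solve 5 (λ x y z u v → x :+ y :+ z :+ u :+ v := x :+ v :+ (z :+ u :+ y)) refl (p a) (q (suc a)) Σ' (p (suc a ℕ.+ n)) (q a) ⟩
    p a + q a + (Σ' + p (suc a ℕ.+ n) + q (suc a))
      ≡⟨ cong (_+_ (p a + q a)) (sumFrom-shifted-+ (suc a) n p q) ⟩
    p a + q a + sumFrom (suc a) (suc n) (λ k → p k + q k) ∎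
  where
  open ≡-Reasoning
  open QS
  Σ' : ℚ
  Σ' = sumFrom (suc a) n (λ k → p k + q (suc k))

-- Sums weighted by reciprocal binomial coefficients

weight : ℕ → ℕ → ℚ
weight m k = 1/ℕ (2 ℕ.^ (k ℕ.+ 1) ℕ.* (m C k))

weight-Pascal : ∀ {m k} → k ℕ.≤ m →
  fromℕ (2 ℕ.+ m) * weight m k ≡ fromℕ (suc m) * (weight (suc m) k + fromℕ 2 * weight (suc m) (suc k))
weight-Pascal {m} {k} k≤m = begin
    fromℕ (2 ℕ.+ m) * weight m k
      ≡⟨ cong (fromℕ (2 ℕ.+ m) *_) (1/ℕ-* (2 ℕ.^ (k ℕ.+ 1)) (m C k)) ⟩
    fromℕ (2 ℕ.+ m) * (p * 1/ℕ (m C k))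
      ≡⟨ solve 3 (λ a p c → a :* (p :* c) := p :* (a :* c)) refl (fromℕ (2 ℕ.+ m)) p (1/ℕ (m C k)) ⟩
    p * (fromℕ (2 ℕ.+ m) * 1/ℕ (m C k))
      ≡⟨ cong (p *_) (1/nCk-Pascal k≤m) ⟩
    p * (fromℕ (suc m) * (1/ℕ d + 1/ℕ e))
      ≡⟨ solve 4 (λ p b d e → p :* (b :* (d :+ e)) := b :* (p :* d :+ con 1ℚ :* (p :* e))) refl p (fromℕ (suc m)) (1/ℕ d) (1/ℕ e) ⟩
    fromℕ (suc m) * (p * 1/ℕ d + 1ℚ * (p * 1/ℕ e))
      ≡⟨ cong (λ x → fromℕ (suc m) * (p * 1/ℕ d + x * (p * 1/ℕ e))) (fromℕ*1/ℕ 2) ⟨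
    fromℕ (suc m) * (p * 1/ℕ d + (fromℕ 2 * 1/ℕ 2) * (p * 1/ℕ e))
      ≡⟨ cong (λ x → fromℕ (suc m) * (p * 1/ℕ d + x)) (ℚ.*-assoc (fromℕ 2) (1/ℕ 2) (p * 1/ℕ e)) ⟩
    fromℕ (suc m) * (p * 1/ℕ d + fromℕ 2 * (1/ℕ 2 * (p * 1/ℕ e)))
      ≡⟨ cong₂ (λ x y → fromℕ (suc m) * (x + fromℕ 2 * y)) (1/ℕ-* (2 ℕ.^ (k ℕ.+ 1)) d)
           (trans (1/ℕ-* (2 ℕ.* 2 ℕ.^ (k ℕ.+ 1)) e)
             (trans (cong (_* 1/ℕ e) (1/ℕ-* 2 (2 ℕ.^ (k ℕ.+ 1)))) (ℚ.*-assoc (1/ℕ 2) p (1/ℕ e)))) ⟨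
    fromℕ (suc m) * (weight (suc m) k + fromℕ 2 * weight (suc m) (suc k)) ∎
  where
  open ≡-Reasoning
  open QS
  p : ℚ
  p = 1/ℕ (2 ℕ.^ (k ℕ.+ 1))
  d e : ℕ
  d = suc m C k
  e = suc m C suc k

weight-diagonal : ∀ m → weight m m ≡ 1/ℕ (2 ℕ.^ suc m)
weight-diagonal m = cong 1/ℕ_ (trans (cong (2 ℕ.^ (m ℕ.+ 1) ℕ.*_) (nCn≡1 m))
  (trans (ℕ.*-identityʳ _) (cong (2 ℕ.^_) (ℕ.+-comm m 1))))

invBinomialSum : ℕ → (ℕ → ℚ) → ℚ
invBinomialSum m g = sumFrom 0 (suc m) (λ k → g (suc k) * weight m k)

-- Pascal's rule splits each weight in two; re-pairing g(k+1) with 2 g(k) under the shifted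
-- weights gives c h(k+1), up to the two end terms g(m+2)/2^{m+2} and g(0).
invBinomialSum-step : ∀ (c : ℚ) (g h : ℕ → ℚ) → (∀ k → c * h (suc k) ≡ g (suc k) + fromℕ 2 * g k) → ∀ m →
  fromℕ (2 ℕ.+ m) * invBinomialSum m g
    ≡ fromℕ (suc m) * (c * invBinomialSum (suc m) h - g (2 ℕ.+ m) * 1/ℕ (2 ℕ.^ (2 ℕ.+ m)) - g 0)
invBinomialSum-step c g h ch≡g+2g m = begin
    fromℕ (2 ℕ.+ m) * invBinomialSum m g
      ≡⟨ *-distribˡ-sumFrom (fromℕ (2 ℕ.+ m)) 0 (suc m) (λ k → g (suc k) * weight m k) ⟩
    sumFrom 0 (suc m) (λ k → fromℕ (2 ℕ.+ m) * (g (suc k) * weight m k))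
      ≡⟨ sumFrom-cong 0 (suc m) (λ k _ k<1+m → split k (ℕ.≤-pred k<1+m)) ⟩
    sumFrom 0 (suc m) (λ k → fromℕ (suc m) * (a k + b (suc k)))
      ≡⟨ *-distribˡ-sumFrom (fromℕ (suc m)) 0 (suc m) (λ k → a k + b (suc k)) ⟨
    fromℕ (suc m) * Σab
      ≡⟨ cong (fromℕ (suc m) *_) (solve 3 (λ x y z → x := x :+ y :+ z :- y :- z) refl Σab (a (suc m)) (b 0)) ⟩
    fromℕ (suc m) * (Σab + a (suc m) + b 0 - a (suc m) - b 0)
      ≡⟨ cong (λ x → fromℕ (suc m) * (x - a (suc m) - b 0)) (sumFrom-shifted-+ 0 (suc m) a b) ⟩
    fromℕ (suc m) * (sumFrom 0 (2 ℕ.+ m) (λ k → a k + b k) - a (suc m) - b 0)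
      ≡⟨ cong₂ (λ x y → fromℕ (suc m) * (x - y - b 0)) pairedTerms lastTerm ⟩
    fromℕ (suc m) * (c * S′ - gₘ₊₂ - b 0)
      ≡⟨ cong (λ z → fromℕ (suc m) * (c * S′ - gₘ₊₂ - z)) firstTerm ⟩
    fromℕ (suc m) * (c * S′ - gₘ₊₂ - g 0) ∎
  where
  open ≡-Reasoning
  open QS
  a b : ℕ → ℚ
  a k = g (suc k) * weight (suc m) k
  b k = fromℕ 2 * g k * weight (suc m) k
  Σab S′ gₘ₊₂ : ℚ
  Σab = sumFrom 0 (suc m) (λ k → a k + b (suc k))
  S′ = invBinomialSum (suc m) h
  gₘ₊₂ = g (2 ℕ.+ m) * 1/ℕ (2 ℕ.^ (2 ℕ.+ m))

  split : ∀ k → k ℕ.≤ m → fromℕ (2 ℕ.+ m) * (g (suc k) * weight m k) ≡ fromℕ (suc m) * (a k + b (suc k))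
  split k k≤m = begin
    fromℕ (2 ℕ.+ m) * (g (suc k) * weight m k)
      ≡⟨ solve 3 (λ x y z → x :* (y :* z) := y :* (x :* z)) refl (fromℕ (2 ℕ.+ m)) (g (suc k)) (weight m k) ⟩
    g (suc k) * (fromℕ (2 ℕ.+ m) * weight m k)
      ≡⟨ cong (g (suc k) *_) (weight-Pascal k≤m) ⟩
    g (suc k) * (fromℕ (suc m) * (weight (suc m) k + fromℕ 2 * weight (suc m) (suc k)))
      ≡⟨ solve 5 (λ y n u t v → y :* (n :* (u :+ t :* v)) := n :* (y :* u :+ t :* y :* v))
           refl (g (suc k)) (fromℕ (suc m)) (weight (suc m) k) (fromℕ 2) (weight (suc m) (suc k)) ⟩
    fromℕ (suc m) * (a k + b (suc k)) ∎

  pairedTerms : sumFrom 0 (2 ℕ.+ m) (λ k → a k + b k) ≡ c * S′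
  pairedTerms = trans (sumFrom-cong 0 (2 ℕ.+ m) λ k _ _ →
      trans (solve 4 (λ y t z w → y :* w :+ t :* z :* w := (y :+ t :* z) :* w) refl (g (suc k)) (fromℕ 2) (g k) (weight (suc m) k))
      (trans (cong (_* weight (suc m) k) (sym (ch≡g+2g k))) (ℚ.*-assoc c (h (suc k)) (weight (suc m) k))))
    (sym (*-distribˡ-sumFrom c 0 (2 ℕ.+ m) (λ k → h (suc k) * weight (suc m) k)))

  lastTerm : a (suc m) ≡ gₘ₊₂
  lastTerm = cong (g (2 ℕ.+ m) *_) (weight-diagonal (suc m))

  firstTerm : b 0 ≡ g 0
  firstTerm = trans (solve 3 (λ t y w → t :* y :* w := y :* (t :* w)) refl (fromℕ 2) (g 0) (weight (suc m) 0))
    (trans (cong (g 0 *_) (fromℕ*1/ℕ 2)) (ℚ.*-identityʳ (g 0)))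

normalizedSum : ℕ → (ℕ → ℚ) → ℚ
normalizedSum m g = 1/ℕ (suc m) * invBinomialSum m g

fromℕ*normalizedSum : ∀ m g → fromℕ (suc m) * normalizedSum m g ≡ invBinomialSum m g
fromℕ*normalizedSum m g = trans (sym (ℚ.*-assoc (fromℕ (suc m)) (1/ℕ (suc m)) _))
  (trans (cong (_* invBinomialSum m g) (fromℕ*1/ℕ (suc m))) (ℚ.*-identityˡ _))

boundary : ℕ → (ℕ → ℚ) → ℚ
boundary p g = (g 0 + g p * 1/ℕ (2 ℕ.^ p)) * 1/ℕ p

normalizedSum-step : ∀ (c : ℚ) (g h : ℕ → ℚ) → (∀ k → c * h (suc k) ≡ g (suc k) + fromℕ 2 * g k) → ∀ m →
  normalizedSum m g ≡ c * normalizedSum (suc m) h - boundary (2 ℕ.+ m) g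
normalizedSum-step c g h ch≡g+2g m = begin
    i₁ * S
      ≡⟨ solve 2 (λ i S → i :* S := i :* con 1ℚ :* S) refl i₁ S ⟩
    i₁ * 1ℚ * S
      ≡⟨ cong (λ x → i₁ * x * S) (fromℕ*1/ℕ (2 ℕ.+ m)) ⟨
    i₁ * (fromℕ (2 ℕ.+ m) * i₂) * S
      ≡⟨ solve 4 (λ i₁ n₂ i₂ S → i₁ :* (n₂ :* i₂) :* S := i₁ :* i₂ :* (n₂ :* S)) refl i₁ (fromℕ (2 ℕ.+ m)) i₂ S ⟩
    i₁ * i₂ * (fromℕ (2 ℕ.+ m) * S)
      ≡⟨ cong (i₁ * i₂ *_) (invBinomialSum-step c g h ch≡g+2g m) ⟩
    i₁ * i₂ * (fromℕ (suc m) * (c * S′ - x - g 0))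
      ≡⟨ solve 7 (λ i₁ i₂ n₁ c S′ x g₀ → i₁ :* i₂ :* (n₁ :* (c :* S′ :- x :- g₀)) := (n₁ :* i₁) :* (c :* (i₂ :* S′) :- (g₀ :+ x) :* i₂))
           refl i₁ i₂ (fromℕ (suc m)) c S′ x (g 0) ⟩
    (fromℕ (suc m) * i₁) * (c * (i₂ * S′) - (g 0 + x) * i₂)
      ≡⟨ trans (cong (_* (c * (i₂ * S′) - (g 0 + x) * i₂)) (fromℕ*1/ℕ (suc m))) (ℚ.*-identityˡ _) ⟩
    c * (i₂ * S′) - (g 0 + x) * i₂ ∎
  where
  open ≡-Reasoning
  open QS
  i₁ i₂ S S′ x : ℚ
  i₁ = 1/ℕ (suc m)
  i₂ = 1/ℕ (2 ℕ.+ m)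
  S = invBinomialSum m g
  S′ = invBinomialSum (suc m) h
  x = g (2 ℕ.+ m) * 1/ℕ (2 ℕ.^ (2 ℕ.+ m))

sumFrom-boundary : ∀ a n (w : ℕ → ℚ) (e : ℕ → ℕ) (g : ℕ → ℚ) →
  sumFrom a n (λ j → w j * boundary (e j) g)
    ≡ g 0 * sumFrom a n (λ j → w j * 1/ℕ (e j)) + sumFrom a n (λ j → w j * (g (e j) * 1/ℕ (2 ℕ.^ e j ℕ.* e j)))
sumFrom-boundary a n w e g = begin
    sumFrom a n (λ j → w j * boundary (e j) g)
      ≡⟨ sumFrom-cong a n (λ j _ _ → split j) ⟩
    sumFrom a n (λ j → g 0 * (w j * 1/ℕ (e j)) + w j * (g (e j) * 1/ℕ (2 ℕ.^ e j ℕ.* e j)))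
      ≡⟨ sumFrom-+ a n _ _ ⟩
    sumFrom a n (λ j → g 0 * (w j * 1/ℕ (e j))) + sumFrom a n (λ j → w j * (g (e j) * 1/ℕ (2 ℕ.^ e j ℕ.* e j)))
      ≡⟨ cong (_+ sumFrom a n (λ j → w j * (g (e j) * 1/ℕ (2 ℕ.^ e j ℕ.* e j)))) (*-distribˡ-sumFrom (g 0) a n _) ⟨
    g 0 * sumFrom a n (λ j → w j * 1/ℕ (e j)) + sumFrom a n (λ j → w j * (g (e j) * 1/ℕ (2 ℕ.^ e j ℕ.* e j))) ∎
  where
  open ≡-Reasoning
  open QS
  split : ∀ j → w j * boundary (e j) g ≡ g 0 * (w j * 1/ℕ (e j)) + w j * (g (e j) * 1/ℕ (2 ℕ.^ e j ℕ.* e j))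
  split j = trans (solve 5 (λ w g₀ x t i → w :* ((g₀ :+ x :* t) :* i) := g₀ :* (w :* i) :+ w :* (x :* (t :* i)))
      refl (w j) (g 0) (g (e j)) (1/ℕ (2 ℕ.^ e j)) (1/ℕ (e j)))
    (cong (λ y → g 0 * (w j * 1/ℕ (e j)) + w j * (g (e j) * y)) (sym (1/ℕ-* (2 ℕ.^ e j) (e j))))

module CoupledSequences (c d r : ℚ) (cd≡r : c * d ≡ r) (g h : ℕ → ℚ)
  (ch≡g+2g : ∀ k → c * h (suc k) ≡ g (suc k) + fromℕ 2 * g k)
  (dg≡h+2h : ∀ k → d * g (suc k) ≡ h (suc k) + fromℕ 2 * h k) where

  normalizedSum-two-step : ∀ m →
    r * normalizedSum (2 ℕ.+ m) g ≡ normalizedSum m g + boundary (2 ℕ.+ m) g + c * boundary (3 ℕ.+ m) h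
  normalizedSum-two-step m = begin
      r * N₂
        ≡⟨ cong (_* N₂) cd≡r ⟨
      c * d * N₂
        ≡⟨ solve 4 (λ c d N₂ B → c :* d :* N₂ := c :* (d :* N₂ :- B) :+ c :* B) refl c d N₂ Bh ⟩
      c * (d * N₂ - Bh) + c * Bh
        ≡⟨ cong (λ x → c * x + c * Bh) (normalizedSum-step d h g dg≡h+2h (suc m)) ⟨
      c * N₁ + c * Bh
        ≡⟨ solve 4 (λ c N₁ Bh Bg → c :* N₁ :+ c :* Bh := c :* N₁ :- Bg :+ Bg :+ c :* Bh) refl c N₁ Bh Bg ⟩
      c * N₁ - Bg + Bg + c * Bh
        ≡⟨ cong (λ x → x + Bg + c * Bh) (normalizedSum-step c g h ch≡g+2g m) ⟨
      normalizedSum m g + Bg + c * Bh ∎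
    where
    open ≡-Reasoning
    open QS
    N₁ N₂ Bg Bh : ℚ
    N₁ = normalizedSum (suc m) h
    N₂ = normalizedSum (2 ℕ.+ m) g
    Bg = boundary (2 ℕ.+ m) g
    Bh = boundary (3 ℕ.+ m) h

  closedForm : ℕ → ℚ
  closedForm n = sumFrom 1 n (λ j → r ^ j * boundary (2 ℕ.* j) g)
               + c * sumFrom 0 (suc n) (λ j → r ^ j * boundary (2 ℕ.* j ℕ.+ 1) h)

  normalizedSum-closedForm : ∀ n → r ^ suc n * normalizedSum (2 ℕ.* n) g ≡ closedForm n
  normalizedSum-closedForm zero = begin
      r * 1ℚ * (1/ℕ 1 * (g 1 * ½ + 0ℚ))
        ≡⟨ cong₂ (λ x y → x * 1ℚ * (y * (g 1 * ½ + 0ℚ))) (sym cd≡r) 1/ℕ1≡1 ⟩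
      c * d * 1ℚ * (1ℚ * (g 1 * ½ + 0ℚ))
        ≡⟨ solve 4 (λ c d g₁ ½ → c :* d :* con 1ℚ :* (con 1ℚ :* (g₁ :* ½ :+ con 0ℚ)) := c :* (d :* g₁) :* ½) refl c d (g 1) ½ ⟩
      c * (d * g 1) * ½
        ≡⟨ cong (λ x → c * x * ½) (dg≡h+2h 0) ⟩
      c * (h 1 + fromℕ 2 * h 0) * ½
        ≡⟨ solve 5 (λ c h₁ t h₀ ½ → c :* (h₁ :+ t :* h₀) :* ½ := c :* (h₀ :* (t :* ½) :+ h₁ :* ½)) refl c (h 1) (fromℕ 2) (h 0) ½ ⟩
      c * (h 0 * (fromℕ 2 * ½) + h 1 * ½)
        ≡⟨ cong (λ x → c * (h 0 * x + h 1 * ½)) (fromℕ*1/ℕ 2) ⟩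
      c * (h 0 * 1ℚ + h 1 * ½)
        ≡⟨ solve 4 (λ c h₀ h₁ ½ → c :* (h₀ :* con 1ℚ :+ h₁ :* ½) := con 0ℚ :+ c :* (con 1ℚ :* ((h₀ :+ h₁ :* ½) :* con 1ℚ) :+ con 0ℚ))
             refl c (h 0) (h 1) ½ ⟩
      0ℚ + c * (1ℚ * ((h 0 + h 1 * ½) * 1ℚ) + 0ℚ)
        ≡⟨ cong (λ y → 0ℚ + c * (1ℚ * ((h 0 + h 1 * ½) * y) + 0ℚ)) 1/ℕ1≡1 ⟨
      closedForm 0 ∎
    where
    open ≡-Reasoning
    open QS
    ½ : ℚ
    ½ = 1/ℕ 2
  normalizedSum-closedForm (suc n) = begin
      r ^ (2 ℕ.+ n) * normalizedSum (2 ℕ.* suc n) g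
        ≡⟨ cong (λ p → r ^ (2 ℕ.+ n) * normalizedSum p g) 2[1+n]≡2+2n ⟩
      r * q * normalizedSum (2 ℕ.+ 2 ℕ.* n) g
        ≡⟨ solve 3 (λ r q N → r :* q :* N := q :* (r :* N)) refl r q (normalizedSum (2 ℕ.+ 2 ℕ.* n) g) ⟩
      q * (r * normalizedSum (2 ℕ.+ 2 ℕ.* n) g)
        ≡⟨ cong (q *_) (normalizedSum-two-step (2 ℕ.* n)) ⟩
      q * (normalizedSum (2 ℕ.* n) g + Bg + c * Bh)
        ≡⟨ solve 5 (λ q N Bg c Bh → q :* (N :+ Bg :+ c :* Bh) := q :* N :+ q :* Bg :+ c :* (q :* Bh)) refl q (normalizedSum (2 ℕ.* n) g) Bg c Bh ⟩
      q * normalizedSum (2 ℕ.* n) g + q * Bg + c * (q * Bh)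
        ≡⟨ cong (λ x → x + q * Bg + c * (q * Bh)) (normalizedSum-closedForm n) ⟩
      Σg + c * Σh + q * Bg + c * (q * Bh)
        ≡⟨ solve 5 (λ Σg c Σh qBg qBh → Σg :+ c :* Σh :+ qBg :+ c :* qBh := (Σg :+ qBg) :+ c :* (Σh :+ qBh)) refl Σg c Σh (q * Bg) (q * Bh) ⟩
      (Σg + q * Bg) + c * (Σh + q * Bh)
        ≡⟨ cong₂ (λ x y → x + c * y)
             (trans (sumFrom-snoc 1 n (λ j → r ^ j * boundary (2 ℕ.* j) g)) (cong (λ p → Σg + q * boundary p g) 2[1+n]≡2+2n))
             (trans (sumFrom-snoc 0 (suc n) (λ j → r ^ j * boundary (2 ℕ.* j ℕ.+ 1) h)) (cong (λ p → Σh + q * boundary p h) 2[1+n]+1≡3+2n)) ⟨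
      closedForm (suc n) ∎
    where
    open ≡-Reasoning
    open QS
    q Bg Bh Σg Σh : ℚ
    q = r ^ suc n
    Bg = boundary (2 ℕ.+ 2 ℕ.* n) g
    Bh = boundary (3 ℕ.+ 2 ℕ.* n) h
    Σg = sumFrom 1 n (λ j → r ^ j * boundary (2 ℕ.* j) g)
    Σh = sumFrom 0 (suc n) (λ j → r ^ j * boundary (2 ℕ.* j ℕ.+ 1) h)
    2[1+n]≡2+2n : 2 ℕ.* suc n ≡ 2 ℕ.+ 2 ℕ.* n
    2[1+n]≡2+2n = ℕ.*-suc 2 n
    2[1+n]+1≡3+2n : 2 ℕ.* suc n ℕ.+ 1 ≡ 3 ℕ.+ 2 ℕ.* n
    2[1+n]+1≡3+2n = trans (cong (ℕ._+ 1) 2[1+n]≡2+2n) (ℕ.+-comm (2 ℕ.+ 2 ℕ.* n) 1)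

  invBinomialSum-closedForm : ∀ N .{{_ : NonZero N}} → r ≡ fromℕ N → ∀ n →
    invBinomialSum (2 ℕ.* n) g ≡ (+ (2 ℕ.* n ℕ.+ 1)) /ℕ (N ℕ.^ (n ℕ.+ 1)) * closedForm n
  invBinomialSum-closedForm N r≡N n = begin
      invBinomialSum (2 ℕ.* n) g
        ≡⟨ fromℕ*normalizedSum (2 ℕ.* n) g ⟨
      fromℕ (suc (2 ℕ.* n)) * N₀
        ≡⟨ solve 2 (λ a N₀ → a :* N₀ := a :* (con 1ℚ :* N₀)) refl (fromℕ (suc (2 ℕ.* n))) N₀ ⟩
      fromℕ (suc (2 ℕ.* n)) * (1ℚ * N₀)
        ≡⟨ cong (λ x → fromℕ (suc (2 ℕ.* n)) * (x * N₀)) (fromℕ*1/ℕ (N ℕ.^ (n ℕ.+ 1)) {{ℕ.m^n≢0 N (n ℕ.+ 1)}}) ⟨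
      fromℕ (suc (2 ℕ.* n)) * (fromℕ M * 1/ℕ M * N₀)
        ≡⟨ solve 4 (λ a m i N₀ → a :* (m :* i :* N₀) := a :* i :* (m :* N₀)) refl (fromℕ (suc (2 ℕ.* n))) (fromℕ M) (1/ℕ M) N₀ ⟩
      fromℕ (suc (2 ℕ.* n)) * 1/ℕ M * (fromℕ M * N₀)
        ≡⟨ cong₂ _*_ coefficient (trans (cong (_* N₀) fromℕM≡r^[1+n]) (normalizedSum-closedForm n)) ⟩
      (+ (2 ℕ.* n ℕ.+ 1)) /ℕ M * closedForm n ∎
    where
    open ≡-Reasoning
    open QS
    M : ℕ
    M = N ℕ.^ (n ℕ.+ 1)
    N₀ : ℚ
    N₀ = normalizedSum (2 ℕ.* n) g
    coefficient : fromℕ (suc (2 ℕ.* n)) * 1/ℕ M ≡ (+ (2 ℕ.* n ℕ.+ 1)) /ℕ M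
    coefficient = trans (cong (λ k → fromℕ k * 1/ℕ M) (ℕ.+-comm 1 (2 ℕ.* n))) (sym (/ℕ-as-* (+ (2 ℕ.* n ℕ.+ 1)) M))
    fromℕM≡r^[1+n] : fromℕ M ≡ r ^ suc n
    fromℕM≡r^[1+n] = trans (cong (λ k → fromℕ (N ℕ.^ k)) (ℕ.+-comm n 1)) (trans (fromℕ-^ N (suc n)) (cong (_^ suc n) (sym r≡N)))

-- Fibonacci and Lucas numbers at integer indices

lucℕ-via-fibℕ : ∀ n → lucℕ (suc n) ≡ fibℕ (suc n) ℕ.+ 2 ℕ.* fibℕ n
lucℕ-via-fibℕ zero = refl
lucℕ-via-fibℕ (suc zero) = refl
lucℕ-via-fibℕ (suc (suc n)) = trans (cong₂ ℕ._+_ (lucℕ-via-fibℕ (suc n)) (lucℕ-via-fibℕ n))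
  (solve 3 (λ a b c → a :+ con 2 :* b :+ (b :+ con 2 :* c) := a :+ b :+ con 2 :* (b :+ c)) refl (fibℕ (2 ℕ.+ n)) (fibℕ (suc n)) (fibℕ n))
  where open NS

5fibℕ-via-lucℕ : ∀ n → 5 ℕ.* fibℕ (suc n) ≡ lucℕ (suc n) ℕ.+ 2 ℕ.* lucℕ n
5fibℕ-via-lucℕ zero = refl
5fibℕ-via-lucℕ (suc zero) = refl
5fibℕ-via-lucℕ (suc (suc n)) = trans (ℕ.*-distribˡ-+ 5 (fibℕ (2 ℕ.+ n)) (fibℕ (suc n)))
  (trans (cong₂ ℕ._+_ (5fibℕ-via-lucℕ (suc n)) (5fibℕ-via-lucℕ n))
  (solve 3 (λ a b c → a :+ con 2 :* b :+ (b :+ con 2 :* c) := a :+ b :+ con 2 :* (b :+ c)) refl (lucℕ (2 ℕ.+ n)) (lucℕ (suc n)) (lucℕ n)))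
  where open NS

L-via-F : ∀ M → L M ≡ F M ℤ.+ + 2 ℤ.* F (M ℤ.- + 1)
L-via-F (+ zero) = refl
L-via-F (+ suc n) = trans (cong +_ (lucℕ-via-fibℕ n)) (cong (ℤ._+_ (+ fibℕ (suc n))) (ℤ.pos-* 2 (fibℕ n)))
-- Here -[1+ k ] - 1 normalises to -[1+ suc (k + 0) ].
L-via-F -[1+ k ] rewrite ℕ.+-identityʳ k = begin
    ℤ.- σ ℤ.* + lucℕ (suc k)
      ≡⟨ cong (ℤ.- σ ℤ.*_) (L-via-F (+ suc k)) ⟩
    ℤ.- σ ℤ.* (+ fibℕ (suc k) ℤ.+ + 2 ℤ.* + fibℕ k)
      ≡⟨ solve 3 (λ σ a b → :- σ :* (a :+ con (+ 2) :* b) := σ :* a :+ con (+ 2) :* (:- σ :* (a :+ b))) refl σ (+ fibℕ (suc k)) (+ fibℕ k) ⟩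
    σ ℤ.* + fibℕ (suc k) ℤ.+ + 2 ℤ.* (ℤ.- σ ℤ.* + fibℕ (2 ℕ.+ k)) ∎
  where
  open ≡-Reasoning
  open ZS
  σ : ℤ
  σ = sgn k

5F-via-L : ∀ M → + 5 ℤ.* F M ≡ L M ℤ.+ + 2 ℤ.* L (M ℤ.- + 1)
5F-via-L (+ zero) = refl
5F-via-L (+ suc n) = trans (sym (ℤ.pos-* 5 (fibℕ (suc n)))) (trans (cong +_ (5fibℕ-via-lucℕ n)) (cong (ℤ._+_ (+ lucℕ (suc n))) (ℤ.pos-* 2 (lucℕ n))))
5F-via-L -[1+ k ] rewrite ℕ.+-identityʳ k = begin
    + 5 ℤ.* (σ ℤ.* + fibℕ (suc k))
      ≡⟨ solve 2 (λ σ a → con (+ 5) :* (σ :* a) := σ :* (con (+ 5) :* a)) refl σ (+ fibℕ (suc k)) ⟩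
    σ ℤ.* (+ 5 ℤ.* + fibℕ (suc k))
      ≡⟨ cong (σ ℤ.*_) (5F-via-L (+ suc k)) ⟩
    σ ℤ.* (+ lucℕ (suc k) ℤ.+ + 2 ℤ.* + lucℕ k)
      ≡⟨ solve 3 (λ σ a b → σ :* (a :+ con (+ 2) :* b) := :- σ :* a :+ con (+ 2) :* (:- (:- σ) :* (a :+ b))) refl σ (+ lucℕ (suc k)) (+ lucℕ k) ⟩
    ℤ.- σ ℤ.* + lucℕ (suc k) ℤ.+ + 2 ℤ.* (ℤ.- (ℤ.- σ) ℤ.* + lucℕ (2 ℕ.+ k)) ∎
  where
  open ≡-Reasoning
  open ZS
  σ : ℤ
  σ = sgn k

shift : (ℤ → ℤ) → ℤ → ℕ → ℚ
shift G s k = fromℤ (G (+ k ℤ.+ s ℤ.- + 1))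

shift-zero : ∀ G s → shift G s 0 ≡ fromℤ (G (s ℤ.- + 1))
shift-zero G s = cong (λ i → fromℤ (G (i ℤ.- + 1))) (ℤ.+-identityˡ s)

shift-+1 : ∀ G s k → shift G s (k ℕ.+ 1) ≡ fromℤ (G (+ k ℤ.+ s))
shift-+1 G s k = cong (fromℤ ∘ G) (solve 2 (λ k s → k :+ con (+ 1) :+ s :- con (+ 1) := k :+ s) refl (+ k) s)
  where open ZS

shift-suc : ∀ G s k → shift G s (suc k) ≡ fromℤ (G (+ k ℤ.+ s))
shift-suc G s k = trans (cong (shift G s) (ℕ.+-comm 1 k)) (shift-+1 G s k)

shift-L-via-F : ∀ s k → shift L s (suc k) ≡ shift F s (suc k) + fromℕ 2 * shift F s k
shift-L-via-F s k = begin
    shift L s (suc k)                                   ≡⟨ shift-suc L s k ⟩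
    fromℤ (L M)                                         ≡⟨ cong fromℤ (L-via-F M) ⟩
    fromℤ (F M ℤ.+ + 2 ℤ.* F (M ℤ.- + 1))              ≡⟨ trans (fromℤ-+ _ _) (cong (_+_ (fromℤ (F M))) (fromℤ-* (+ 2) _)) ⟩
    fromℤ (F M) + fromℕ 2 * shift F s k                 ≡⟨ cong (_+ fromℕ 2 * shift F s k) (shift-suc F s k) ⟨
    shift F s (suc k) + fromℕ 2 * shift F s k ∎
  where
  open ≡-Reasoning
  M : ℤ
  M = + k ℤ.+ s

shift-5F-via-L : ∀ s k → fromℕ 5 * shift F s (suc k) ≡ shift L s (suc k) + fromℕ 2 * shift L s k
shift-5F-via-L s k = begin
    fromℕ 5 * shift F s (suc k)                         ≡⟨ cong (fromℕ 5 *_) (shift-suc F s k) ⟩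
    fromℕ 5 * fromℤ (F M)                               ≡⟨ fromℤ-* (+ 5) (F M) ⟨
    fromℤ (+ 5 ℤ.* F M)                                 ≡⟨ cong fromℤ (5F-via-L M) ⟩
    fromℤ (L M ℤ.+ + 2 ℤ.* L (M ℤ.- + 1))              ≡⟨ trans (fromℤ-+ _ _) (cong (_+_ (fromℤ (L M))) (fromℤ-* (+ 2) _)) ⟩
    fromℤ (L M) + fromℕ 2 * shift L s k                 ≡⟨ cong (_+ fromℕ 2 * shift L s k) (shift-suc L s k) ⟨
    shift L s (suc k) + fromℕ 2 * shift L s k ∎
  where
  open ≡-Reasoning
  M : ℤ
  M = + k ℤ.+ s

sumFrom-/ℕ-shift : ∀ G s m →
  sumFrom 0 (suc m) (λ j → G (+ j ℤ.+ s) /ℕ (2 ℕ.^ (j ℕ.+ 1) ℕ.* (m C j))) ≡ invBinomialSum m (shift G s)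
sumFrom-/ℕ-shift G s m = sumFrom-cong 0 (suc m) λ j _ _ →
  trans (/ℕ-as-* (G (+ j ℤ.+ s)) _) (cong (_* weight m j) (sym (shift-suc G s j)))

sumFrom-^/ℕ : ∀ b (p e : ℕ → ℕ) a n →
  sumFrom a n (λ j → fromℕ b ^ p j * 1/ℕ (e j)) ≡ sumFrom a n (λ j → (+ (b ℕ.^ p j)) /ℕ e j)
sumFrom-^/ℕ b p e a n = sumFrom-cong a n λ j _ _ →
  trans (cong (_* 1/ℕ (e j)) (sym (fromℕ-^ b (p j)))) (sym (/ℕ-as-* (+ (b ℕ.^ p j)) (e j)))

sumFrom-^*/ℕ : ∀ b (p e : ℕ → ℕ) (x : ℕ → ℚ) (z : ℕ → ℤ) a n → (∀ j → x j ≡ fromℤ (z j)) →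
  sumFrom a n (λ j → fromℕ b ^ p j * (x j * 1/ℕ (e j))) ≡ sumFrom a n (λ j → (+ (b ℕ.^ p j) ℤ.* z j) /ℕ e j)
sumFrom-^*/ℕ b p e x z a n x≡z = sumFrom-cong a n λ j _ _ → begin
    fromℕ b ^ p j * (x j * 1/ℕ (e j))             ≡⟨ cong₂ (λ u v → u * (v * 1/ℕ (e j))) (sym (fromℕ-^ b (p j))) (x≡z j) ⟩
    fromℕ (b ℕ.^ p j) * (fromℤ (z j) * 1/ℕ (e j))   ≡⟨ ℚ.*-assoc (fromℕ (b ℕ.^ p j)) _ _ ⟨
    fromℕ (b ℕ.^ p j) * fromℤ (z j) * 1/ℕ (e j)     ≡⟨ cong (_* 1/ℕ (e j)) (fromℤ-* (+ (b ℕ.^ p j)) (z j)) ⟨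
    fromℤ (+ (b ℕ.^ p j) ℤ.* z j) * 1/ℕ (e j)       ≡⟨ /ℕ-as-* _ (e j) ⟨
    (+ (b ℕ.^ p j) ℤ.* z j) /ℕ e j ∎
  where open ≡-Reasoning

sumFrom-1-^ : ∀ r n (x : ℕ → ℚ) → sumFrom 1 n (λ j → r ^ j * x j) ≡ r * sumFrom 1 n (λ j → r ^ (j ℕ.∸ 1) * x j)
sumFrom-1-^ r n x = trans (sumFrom-cong 1 n λ { (suc j) _ _ → ℚ.*-assoc r (r ^ j) (x (suc j)) })
  (sym (*-distribˡ-sumFrom r 1 n (λ j → r ^ (j ℕ.∸ 1) * x j)))

/ℕ-^-+1 : ∀ z b n → z /ℕ (b ℕ.^ (n ℕ.+ 1)) ≡ z /ℕ (b ℕ.^ n) * 1/ℕ b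
/ℕ-^-+1 z b n = begin
    z /ℕ (b ℕ.^ (n ℕ.+ 1))                       ≡⟨ /ℕ-as-* z _ ⟩
    fromℤ z * 1/ℕ (b ℕ.^ (n ℕ.+ 1))
      ≡⟨ cong (λ k → fromℤ z * 1/ℕ k) (trans (ℕ.^-distribˡ-+-* b n 1) (cong (b ℕ.^ n ℕ.*_) (ℕ.*-identityʳ b))) ⟩
    fromℤ z * 1/ℕ (b ℕ.^ n ℕ.* b)               ≡⟨ cong (fromℤ z *_) (1/ℕ-* (b ℕ.^ n) b) ⟩
    fromℤ z * (1/ℕ (b ℕ.^ n) * 1/ℕ b)           ≡⟨ ℚ.*-assoc (fromℤ z) _ _ ⟨
    fromℤ z * 1/ℕ (b ℕ.^ n) * 1/ℕ b             ≡⟨ cong (_* 1/ℕ b) (/ℕ-as-* z _) ⟨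
    z /ℕ (b ℕ.^ n) * 1/ℕ b ∎
  where open ≡-Reasoning

module Expansion (s : ℤ) (n : ℕ) where
  open ≡-Reasoning
  open QS

  Fs Ls : ℕ → ℚ
  Fs = shift F s
  Ls = shift L s

  module F∶L = CoupledSequences 1ℚ (fromℕ 5) (fromℕ 5) (ℚ.*-identityˡ _) Fs Ls
    (λ k → trans (ℚ.*-identityˡ _) (shift-L-via-F s k)) (shift-5F-via-L s)
  module L∶F = CoupledSequences (fromℕ 5) 1ℚ (fromℕ 5) (ℚ.*-identityʳ _) Ls Fs
    (shift-5F-via-L s) (λ k → trans (ℚ.*-identityˡ _) (shift-L-via-F s k))

  id ∸1 odd : ℕ → ℕ
  id j = j
  ∸1 j = j ℕ.∸ 1
  odd j = 2 ℕ.* j ℕ.+ 1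

  K₀ K₁ oddSum : ℚ
  K₀ = (+ (2 ℕ.* n ℕ.+ 1)) /ℕ (5 ℕ.^ n)
  K₁ = (+ (2 ℕ.* n ℕ.+ 1)) /ℕ (5 ℕ.^ (n ℕ.+ 1))
  oddSum = sumFrom 0 (suc n) (λ j → fromℕ 5 ^ j * 1/ℕ (odd j))

  evenSum : (ℕ → ℕ) → ℚ
  evenSum p = sumFrom 1 n (λ j → fromℕ 5 ^ p j * 1/ℕ (2 ℕ.* j))

  evenTermSum : (ℕ → ℕ) → (ℕ → ℚ) → ℚ
  evenTermSum p g = sumFrom 1 n (λ j → fromℕ 5 ^ p j * (g (2 ℕ.* j) * 1/ℕ (2 ℕ.^ (2 ℕ.* j) ℕ.* (2 ℕ.* j))))

  oddTermSum : (ℕ → ℚ) → ℚ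
  oddTermSum g = sumFrom 0 (suc n) (λ j → fromℕ 5 ^ j * (g (odd j) * 1/ℕ (2 ℕ.^ odd j ℕ.* odd j)))

  evenBoundaries : ∀ g → sumFrom 1 n (λ j → fromℕ 5 ^ j * boundary (2 ℕ.* j) g) ≡ g 0 * evenSum id + evenTermSum id g
  evenBoundaries = sumFrom-boundary 1 n (fromℕ 5 ^_) (2 ℕ.*_)

  oddBoundaries : ∀ g → sumFrom 0 (suc n) (λ j → fromℕ 5 ^ j * boundary (odd j) g) ≡ g 0 * oddSum + oddTermSum g
  oddBoundaries = sumFrom-boundary 0 (suc n) (fromℕ 5 ^_) odd

  invBinomialSum-Fs : invBinomialSum (2 ℕ.* n) Fs
    ≡ K₁ * (Fs 0 * evenSum id + Ls 0 * oddSum) + K₁ * (evenTermSum id Fs + oddTermSum Ls)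
  invBinomialSum-Fs = begin
    invBinomialSum (2 ℕ.* n) Fs
      ≡⟨ F∶L.invBinomialSum-closedForm 5 refl n ⟩
    K₁ * F∶L.closedForm n
      ≡⟨ cong (K₁ *_) (cong₂ (λ x y → x + 1ℚ * y) (evenBoundaries Fs) (oddBoundaries Ls)) ⟩
    K₁ * (Fs 0 * evenSum id + evenTermSum id Fs + 1ℚ * (Ls 0 * oddSum + oddTermSum Ls))
      ≡⟨ solve 7 (λ K f A C l B D → K :* (f :* A :+ C :+ con 1ℚ :* (l :* B :+ D)) := K :* (f :* A :+ l :* B) :+ K :* (C :+ D))
           refl K₁ (Fs 0) (evenSum id) (evenTermSum id Fs) (Ls 0) oddSum (oddTermSum Ls) ⟩
    K₁ * (Fs 0 * evenSum id + Ls 0 * oddSum) + K₁ * (evenTermSum id Fs + oddTermSum Ls) ∎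

  -- Here c = 5: the prefactor 1/5^{n+1} = 1/5^n · 1/5 cancels the factor 5 on the odd sums and
  -- turns 5^j into 5^{j-1} on the even ones.
  invBinomialSum-Ls : invBinomialSum (2 ℕ.* n) Ls
    ≡ K₀ * (Fs 0 * oddSum + Ls 0 * evenSum ∸1) + K₀ * (oddTermSum Fs + evenTermSum ∸1 Ls)
  invBinomialSum-Ls = begin
    invBinomialSum (2 ℕ.* n) Ls
      ≡⟨ L∶F.invBinomialSum-closedForm 5 refl n ⟩
    K₁ * L∶F.closedForm n
      ≡⟨ cong₂ _*_ (/ℕ-^-+1 _ 5 n) (cong₂ (λ x y → x + fromℕ 5 * y) (evenBoundaries Ls) (oddBoundaries Fs)) ⟩
    K₀ * ⅕ * (Ls 0 * evenSum id + evenTermSum id Ls + fromℕ 5 * (Fs 0 * oddSum + oddTermSum Fs))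
      ≡⟨ cong₂ (λ x y → K₀ * ⅕ * (Ls 0 * x + y + fromℕ 5 * (Fs 0 * oddSum + oddTermSum Fs)))
           (sumFrom-1-^ (fromℕ 5) n _) (sumFrom-1-^ (fromℕ 5) n _) ⟩
    K₀ * ⅕ * (Ls 0 * (fromℕ 5 * evenSum ∸1) + fromℕ 5 * evenTermSum ∸1 Ls + fromℕ 5 * (Fs 0 * oddSum + oddTermSum Fs))
      ≡⟨ solve 9 (λ K i f l A C g B D → K :* i :* (l :* (f :* A) :+ f :* C :+ f :* (g :* B :+ D)) := (f :* i) :* (K :* (g :* B :+ l :* A) :+ K :* (D :+ C)))
           refl K₀ ⅕ (fromℕ 5) (Ls 0) (evenSum ∸1) (evenTermSum ∸1 Ls) (Fs 0) oddSum (oddTermSum Fs) ⟩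
    (fromℕ 5 * ⅕) * rhs
      ≡⟨ trans (cong (_* rhs) (fromℕ*1/ℕ 5)) (ℚ.*-identityˡ rhs) ⟩
    rhs ∎
    where
    ⅕ rhs : ℚ
    ⅕ = 1/ℕ 5
    rhs = K₀ * (Fs 0 * oddSum + Ls 0 * evenSum ∸1) + K₀ * (oddTermSum Fs + evenTermSum ∸1 Ls)

  shift₀ : ∀ G → shift G s 0 ≡ ℚ._/_ (G (s ℤ.- + 1)) 1
  shift₀ G = trans (shift-zero G s) (sym (z/1≡fromℤ _))

  evenSum-/ℕ : ∀ p → evenSum p ≡ ∑[ 1 , n ] (λ j → (+ (5 ℕ.^ p j)) /ℕ (2 ℕ.* j))
  evenSum-/ℕ p = sumFrom-^/ℕ 5 p (2 ℕ.*_) 1 n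

  oddSum-/ℕ : oddSum ≡ ∑[ 0 , n ] (λ j → (+ (5 ℕ.^ j)) /ℕ odd j)
  oddSum-/ℕ = sumFrom-^/ℕ 5 id odd 0 (suc n)

  evenTermSum-/ℕ : ∀ p G → evenTermSum p (shift G s)
    ≡ ∑[ 1 , n ] (λ j → ((+ (5 ℕ.^ p j)) ℤ.* G (+ (2 ℕ.* j) ℤ.+ s ℤ.- + 1)) /ℕ (2 ℕ.^ (2 ℕ.* j) ℕ.* (2 ℕ.* j)))
  evenTermSum-/ℕ p G = sumFrom-^*/ℕ 5 p (λ j → 2 ℕ.^ (2 ℕ.* j) ℕ.* (2 ℕ.* j)) (λ j → shift G s (2 ℕ.* j)) _ 1 n (λ _ → refl)

  oddTermSum-/ℕ : ∀ G → oddTermSum (shift G s)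
    ≡ ∑[ 0 , n ] (λ j → ((+ (5 ℕ.^ j)) ℤ.* G (+ (2 ℕ.* j) ℤ.+ s)) /ℕ (2 ℕ.^ odd j ℕ.* odd j))
  oddTermSum-/ℕ G = sumFrom-^*/ℕ 5 id (λ j → 2 ℕ.^ odd j ℕ.* odd j) (λ j → shift G s (odd j)) _ 0 (suc n) (λ j → shift-+1 G s (2 ℕ.* j))

theorem2 : (n : ℕ) (s : ℤ) →
  (∑[ 0 , 2 ℕ.* n ] (λ j → F (+ j ℤ.+ s) /ℕ (2 ℕ.^ (j ℕ.+ 1) ℕ.* ((2 ℕ.* n) C j)))
    ≡ ((+ (2 ℕ.* n ℕ.+ 1)) /ℕ (5 ℕ.^ (n ℕ.+ 1))) ℚ.*
        ((ℚ._/_ (F (s ℤ.- + 1)) 1) ℚ.* (∑[ 1 , n ] (λ j → (+ (5 ℕ.^ j)) /ℕ (2 ℕ.* j)))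
          ℚ.+ (ℚ._/_ (L (s ℤ.- + 1)) 1) ℚ.* (∑[ 0 , n ] (λ j → (+ (5 ℕ.^ j)) /ℕ (2 ℕ.* j ℕ.+ 1))))
      ℚ.+ ((+ (2 ℕ.* n ℕ.+ 1)) /ℕ (5 ℕ.^ (n ℕ.+ 1))) ℚ.*
        ((∑[ 1 , n ] (λ j → ((+ (5 ℕ.^ j)) ℤ.* F (+ (2 ℕ.* j) ℤ.+ s ℤ.- + 1)) /ℕ (2 ℕ.^ (2 ℕ.* j) ℕ.* (2 ℕ.* j))))
          ℚ.+ (∑[ 0 , n ] (λ j → ((+ (5 ℕ.^ j)) ℤ.* L (+ (2 ℕ.* j) ℤ.+ s)) /ℕ (2 ℕ.^ (2 ℕ.* j ℕ.+ 1) ℕ.* (2 ℕ.* j ℕ.+ 1))))))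
  ×
  (∑[ 0 , 2 ℕ.* n ] (λ j → L (+ j ℤ.+ s) /ℕ (2 ℕ.^ (j ℕ.+ 1) ℕ.* ((2 ℕ.* n) C j)))
    ≡ ((+ (2 ℕ.* n ℕ.+ 1)) /ℕ (5 ℕ.^ n)) ℚ.*
        ((ℚ._/_ (F (s ℤ.- + 1)) 1) ℚ.* (∑[ 0 , n ] (λ j → (+ (5 ℕ.^ j)) /ℕ (2 ℕ.* j ℕ.+ 1)))
          ℚ.+ (ℚ._/_ (L (s ℤ.- + 1)) 1) ℚ.* (∑[ 1 , n ] (λ j → (+ (5 ℕ.^ (j ℕ.∸ 1))) /ℕ (2 ℕ.* j))))
      ℚ.+ ((+ (2 ℕ.* n ℕ.+ 1)) /ℕ (5 ℕ.^ n)) ℚ.*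
        ((∑[ 0 , n ] (λ j → ((+ (5 ℕ.^ j)) ℤ.* F (+ (2 ℕ.* j) ℤ.+ s)) /ℕ (2 ℕ.^ (2 ℕ.* j ℕ.+ 1) ℕ.* (2 ℕ.* j ℕ.+ 1))))
          ℚ.+ (∑[ 1 , n ] (λ j → ((+ (5 ℕ.^ (j ℕ.∸ 1))) ℤ.* L (+ (2 ℕ.* j) ℤ.+ s ℤ.- + 1)) /ℕ (2 ℕ.^ (2 ℕ.* j) ℕ.* (2 ℕ.* j))))))
theorem2 n s =
    trans (sumFrom-/ℕ-shift F s (2 ℕ.* n)) (trans invBinomialSum-Fs
      (cong₂ (λ u v → K₁ * u + K₁ * v)
        (cong₂ _+_ (cong₂ _*_ (shift₀ F) (evenSum-/ℕ id)) (cong₂ _*_ (shift₀ L) oddSum-/ℕ))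
        (cong₂ _+_ (evenTermSum-/ℕ id F) (oddTermSum-/ℕ L))))
  , trans (sumFrom-/ℕ-shift L s (2 ℕ.* n)) (trans invBinomialSum-Ls
      (cong₂ (λ u v → K₀ * u + K₀ * v)
        (cong₂ _+_ (cong₂ _*_ (shift₀ F) oddSum-/ℕ) (cong₂ _*_ (shift₀ L) (evenSum-/ℕ ∸1)))
        (cong₂ _+_ (oddTermSum-/ℕ F) (evenTermSum-/ℕ ∸1 L))))
  where open Expansion s n
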